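{- A finite simple graph $G$ has no induced cycle of length congruent to $0$ or $1$ modulo $3$ if and only if $G$ has no cycle (induced or not) of length congruent to $0$ or $1$ modulo $3$.
   Context: The length of a cycle is its number of edges. -}

module Defs where

open import Data.Nat using (ℕ; zero; suc; _%_; _≤_)
open import Data.Fin using (Fin; zero; suc; toℕ; fromℕ<)
open import Data.Nat.DivMod using (m%n<n)
open import Data.Product using (Σ; _×_; _,_)
open import Data.Sum using (_⊎_)
open import Relation.Binary.PropositionalEquality using (_≡_)
open import Relation.Nullary using (¬_; Dec)
open import Function.Definitions using (Injective)

-- A finite simple graph on the vertex set Fin n:
-- a symmetric, irreflexive adjacency relation (no loops, no multi-edges),
-- decidable (as is any edge set of a finite graph).
record SimpleGraph (n : ℕ) : Set₁ where
  field
    Adj    : Fin n → Fin n → Set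
    sym    : ∀ {u v} → Adj u v → Adj v u
    irrefl : ∀ {v} → ¬ Adj v v
    dec    : ∀ u v → Dec (Adj u v)

open SimpleGraph public

next : ∀ {k} → Fin k → Fin k
next {suc k} i = fromℕ< (m%n<n (suc (toℕ i)) (suc k))

record Cycle {n : ℕ} (G : SimpleGraph n) (k : ℕ) : Set where
  field
    len≥3  : 3 ≤ k
    vert   : Fin k → Fin n
    inj    : Injective _≡_ _≡_ vert
    edges  : ∀ i → Adj G (vert i) (vert (next i))

open Cycle public

Induced : ∀ {n k} {G : SimpleGraph n} → Cycle G k → Set
Induced {G = G} C =
  ∀ i j → Adj G (vert C i) (vert C j) → (j ≡ next i) ⊎ (i ≡ next j)

Bad : ℕ → Set
Bad k = (k % 3 ≡ 0) ⊎ (k % 3 ≡ 1)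

HasCycleOfLength : ∀ {n} → SimpleGraph n → ℕ → Set
HasCycleOfLength G k = Cycle G k

HasInducedCycleOfLength : ∀ {n} → SimpleGraph n → ℕ → Set
HasInducedCycleOfLength G k = Σ (Cycle G k) Induced

-- A cycle with a chord splits into two shorter cycles whose lengths add up to the
-- original length plus 2. If both pieces had length ≡ 2 (mod 3), the original
-- length would be 2 + 2 − 2 ≡ 2 (mod 3); so a cycle of length ≡ 0 or 1 (mod 3)
-- with a chord contains a strictly shorter one of the same kind, and a shortest
-- such cycle is induced.
module Submission where

open import Defs hiding (sym)
open import Data.Nat using (ℕ; zero; suc; _+_; _%_; _≤_; _<_; NonZero; s≤s; z≤n; >-nonZero)
open import Data.Nat.Properties
open import Data.Nat.DivMod
open import Data.Nat.Induction using (<-rec)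
open import Data.Nat.Tactic.RingSolver using (solve-∀)
open import Data.Fin using (Fin; toℕ)
open import Data.Fin.Properties using (toℕ-fromℕ<; toℕ-injective; toℕ<n; all?; ¬∀⟶∃¬)
  renaming (_≟_ to _≟ᶠ_)
open import Data.Product using (∃; ∃₂; _×_; _,_)
open import Data.Sum using (_⊎_; inj₁; inj₂; [_,_]′)
open import Relation.Binary.Definitions using (tri<; tri≈; tri>)
open import Relation.Binary.PropositionalEquality using (_≡_; _≢_; refl; sym; trans; cong; cong₂; subst; subst₂; module ≡-Reasoning)
open import Relation.Nullary using (¬_; Dec; yes; no; contradiction)
open import Relation.Nullary.Decidable using (_⊎-dec_; _→-dec_)
open import Function using (_∘_; const)

toℕ-next : ∀ {k} .{{_ : NonZero k}} (i : Fin k) → toℕ (next i) ≡ suc (toℕ i) % k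
toℕ-next {suc _} i = toℕ-fromℕ< _

module _ {k : ℕ} .{{_ : NonZero k}} where

  toℕ-mod : ∀ m → toℕ (m mod k) ≡ m % k
  toℕ-mod m = toℕ-fromℕ< (m%n<n m k)

  %-≡⇒mod-≡ : ∀ {m m′} → m % k ≡ m′ % k → m mod k ≡ m′ mod k
  %-≡⇒mod-≡ {m} {m′} eq = toℕ-injective (trans (toℕ-mod m) (trans eq (sym (toℕ-mod m′))))

  [1+m%n]%n≡[1+m]%n : ∀ m → suc (m % k) % k ≡ suc m % k
  [1+m%n]%n≡[1+m]%n m = begin
    (1 + m % k) % k          ≡⟨ %-distribˡ-+ 1 (m % k) k ⟩
    (1 % k + m % k % k) % k  ≡⟨ cong (λ r → (1 % k + r) % k) (m%n%n≡m%n m k) ⟩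
    (1 % k + m % k) % k      ≡⟨ %-distribˡ-+ 1 m k ⟨
    (1 + m) % k              ∎
    where open ≡-Reasoning

  [r+d]%n≡r⇒d≡0 : ∀ {r d} → r < k → d < k → (r + d) % k ≡ r → d ≡ 0
  [r+d]%n≡r⇒d≡0 {r} {d} r<k d<k eq with r + d <? k
  ... | yes r+d<k = +-cancelˡ-≡ r d 0 (trans (sym (m<n⇒m%n≡m r+d<k)) (trans eq (sym (+-identityʳ r))))
  ... | no r+d≮k with m≤n⇒∃[o]m+o≡n (≮⇒≥ r+d≮k)
  ... | e , k+e≡r+d = contradiction (+-cancelˡ-≡ r d k r+d≡r+k) (<⇒≢ d<k)
    where
    e<k : e < k
    e<k = +-cancelˡ-< k e k (subst (_< k + k) (sym k+e≡r+d) (+-mono-< r<k d<k))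
    e≡r : e ≡ r
    e≡r = begin
      e            ≡⟨ m<n⇒m%n≡m e<k ⟨
      e % k        ≡⟨ [m+n]%n≡m%n e k ⟨
      (e + k) % k  ≡⟨ cong (_% k) (trans (+-comm e k) k+e≡r+d) ⟩
      (r + d) % k  ≡⟨ eq ⟩
      r            ∎
      where open ≡-Reasoning
    r+d≡r+k : r + d ≡ r + k
    r+d≡r+k = trans (sym k+e≡r+d) (trans (+-comm k e) (cong (_+ k) e≡r))

  [m+d]%n≡m%n⇒d≡0 : ∀ m {d} → d < k → (m + d) % k ≡ m % k → d ≡ 0
  [m+d]%n≡m%n⇒d≡0 m {d} d<k eq = [r+d]%n≡r⇒d≡0 (m%n<n m k) d<k (begin
    (m % k + d) % k      ≡⟨ cong (λ x → (m % k + x) % k) (m<n⇒m%n≡m d<k) ⟨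
    (m % k + d % k) % k  ≡⟨ %-distribˡ-+ m d k ⟨
    (m + d) % k          ≡⟨ eq ⟩
    m % k                ∎)
    where open ≡-Reasoning

  [m+i]%n≡[m+j]%n⇒i≡j : ∀ m {i j} → i < k → j < k → (m + i) % k ≡ (m + j) % k → i ≡ j
  [m+i]%n≡[m+j]%n⇒i≡j m {i} {j} i<k j<k eq =
    [ (λ i≤j → ≤-cancel i≤j j<k eq) , (λ j≤i → sym (≤-cancel j≤i i<k (sym eq))) ]′ (≤-total i j)
    where
    ≤-cancel : ∀ {i j} → i ≤ j → j < k → (m + i) % k ≡ (m + j) % k → i ≡ j
    ≤-cancel {i} {j} i≤j j<k eq with m≤n⇒∃[o]m+o≡n i≤j
    ... | d , i+d≡j = trans (sym (+-identityʳ i)) (trans (cong (i +_) (sym d≡0)) i+d≡j)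
      where
      d≡0 : d ≡ 0
      d≡0 = [m+d]%n≡m%n⇒d≡0 (m + i) (≤-<-trans (m≤n+m d i) (subst (_< k) (sym i+d≡j) j<k))
              (sym (trans eq (cong (_% k) (trans (cong (m +_) (sym i+d≡j)) (sym (+-assoc m i d))))))

Bad? : ∀ x → Dec (Bad x)
Bad? x = (x % 3 ≟ 0) ⊎-dec (x % 3 ≟ 1)

¬Bad⇒%3≡2 : ∀ x → ¬ Bad x → x % 3 ≡ 2
¬Bad⇒%3≡2 x ¬bad with x % 3 | m%n<n x 3
... | 0 | _ = contradiction (inj₁ refl) ¬bad
... | 1 | _ = contradiction (inj₂ refl) ¬bad
... | 2 | _ = refl
... | suc (suc (suc _)) | s≤s (s≤s (s≤s ()))

%3≡2⇒¬Bad : ∀ x → x % 3 ≡ 2 → ¬ Bad x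
%3≡2⇒¬Bad x x%3≡2 (inj₁ x%3≡0) with trans (sym x%3≡2) x%3≡0
... | ()
%3≡2⇒¬Bad x x%3≡2 (inj₂ x%3≡1) with trans (sym x%3≡2) x%3≡1
... | ()

Bad-split : ∀ x y {k} → x + y ≡ 2 + k → Bad k → Bad x ⊎ Bad y
Bad-split x y {k} x+y≡2+k bad with Bad? x | Bad? y
... | yes bad-x | _         = inj₁ bad-x
... | no _      | yes bad-y = inj₂ bad-y
... | no ¬bad-x | no ¬bad-y = contradiction bad (%3≡2⇒¬Bad k k%3≡2)
  where
  open ≡-Reasoning
  k%3≡2 : k % 3 ≡ 2
  k%3≡2 = begin
    k % 3                          ≡⟨ [m+n]%n≡m%n k 3 ⟨
    (k + 3) % 3                    ≡⟨ cong (_% 3) (trans (+-comm k 3) (cong suc (sym x+y≡2+k))) ⟩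
    (1 + (x + y)) % 3              ≡⟨ %-distribˡ-+ 1 (x + y) 3 ⟩
    (1 + (x + y) % 3) % 3          ≡⟨ cong (λ r → (1 + r) % 3) (%-distribˡ-+ x y 3) ⟩
    (1 + (x % 3 + y % 3) % 3) % 3  ≡⟨ cong₂ (λ r s → (1 + (r + s) % 3) % 3) (¬Bad⇒%3≡2 x ¬bad-x) (¬Bad⇒%3≡2 y ¬bad-y) ⟩
    2                              ∎

2≤1+m+n : ∀ m n → ¬ (m ≡ 0 × n ≡ 0) → 2 ≤ suc m + n
2≤1+m+n zero    zero    m≢0∨n≢0 = contradiction (refl , refl) m≢0∨n≢0
2≤1+m+n zero    (suc n) _       = s≤s (s≤s z≤n)
2≤1+m+n (suc m) n       _       = s≤s (s≤s z≤n)

chord-spans : ∀ {a b k} .{{_ : NonZero k}} → a < b → b < k → b ≢ suc a % k → a ≢ suc b % k →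
              ∃₂ λ span cospan → 2 ≤ span × 2 ≤ cospan × span + cospan ≡ k × a + span ≡ b
chord-spans {a} {b} {k} a<b b<k b≢1+a a≢1+b with m≤n⇒∃[o]m+o≡n a<b | m≤n⇒∃[o]m+o≡n b<k
... | zero , 1+a+0≡b | _ =
  contradiction (trans (sym 1+a+0≡b) (trans (+-identityʳ (suc a)) (sym (m<n⇒m%n≡m (≤-<-trans a<b b<k))))) b≢1+a
... | suc d , 1+a+1+d≡b | e , 1+b+e≡k =
  suc (suc d) , suc e + a , s≤s (s≤s z≤n) , 2≤1+m+n e a e≢0∨a≢0 ,
  trans (rearrange a d e) (trans (cong (λ x → suc x + e) 1+a+1+d≡b) 1+b+e≡k) ,
  trans (+-suc a (suc d)) 1+a+1+d≡b
  where
  rearrange : ∀ a d e → suc (suc d) + (suc e + a) ≡ suc (suc a + suc d) + e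
  rearrange = solve-∀
  e≢0∨a≢0 : ¬ (e ≡ 0 × a ≡ 0)
  e≢0∨a≢0 (e≡0 , a≡0) = a≢1+b (trans a≡0 (sym (trans (cong (_% k) 1+b≡k) (n%n≡0 k))))
    where
    1+b≡k : suc b ≡ k
    1+b≡k = trans (sym (+-identityʳ (suc b))) (trans (cong (suc b +_) (sym e≡0)) 1+b+e≡k)

module _ {n k : ℕ} {G : SimpleGraph n} (C : Cycle G k) where

  private instance
    k-nonZero : NonZero k
    k-nonZero = >-nonZero (≤-trans (s≤s z≤n) (len≥3 C))

  -- Indexing the vertices periodically by ℕ makes every arc of C, also one passing
  -- index 0, a window s, s + 1, …, s + m.
  vertexAt : ℕ → Fin n
  vertexAt t = vert C (t mod k)

  vertexAt-toℕ : ∀ i → vertexAt (toℕ i) ≡ vert C i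
  vertexAt-toℕ i = cong (vert C) (toℕ-injective (trans (toℕ-mod (toℕ i)) (m<n⇒m%n≡m (toℕ<n i))))

  vertexAt-+k : ∀ t → vertexAt (t + k) ≡ vertexAt t
  vertexAt-+k t = cong (vert C) (%-≡⇒mod-≡ ([m+n]%n≡m%n t k))

  vertexAt-adjacent : ∀ t → Adj G (vertexAt t) (vertexAt (suc t))
  vertexAt-adjacent t = subst (Adj G (vertexAt t) ∘ vert C) next≡ (edges C (t mod k))
    where
    open ≡-Reasoning
    next≡ : next (t mod k) ≡ suc t mod k
    next≡ = toℕ-injective (begin
      toℕ (next (t mod k))       ≡⟨ toℕ-next (t mod k) ⟩
      suc (toℕ (t mod k)) % k    ≡⟨ cong (λ r → suc r % k) (toℕ-mod t) ⟩
      suc (t % k) % k            ≡⟨ [1+m%n]%n≡[1+m]%n {k} t ⟩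
      suc t % k                  ≡⟨ toℕ-mod (suc t) ⟨
      toℕ (suc t mod k)          ∎)

  vertexAt-injective : ∀ s {i j} → i < k → j < k → vertexAt (s + i) ≡ vertexAt (s + j) → i ≡ j
  vertexAt-injective s i<k j<k eq =
    [m+i]%n≡[m+j]%n⇒i≡j s i<k j<k (trans (sym (toℕ-mod _)) (trans (cong toℕ (inj C eq)) (toℕ-mod _)))

  arc : ∀ s m → 2 ≤ m → m < k → Adj G (vertexAt (s + m)) (vertexAt s) → Cycle G (suc m)
  arc s m 2≤m m<k closing = record
    { len≥3 = s≤s 2≤m
    ; vert  = λ i → vertexAt (s + toℕ i)
    ; inj   = λ {i} {j} eq →
        toℕ-injective (vertexAt-injective s (<-≤-trans (toℕ<n i) m<k) (<-≤-trans (toℕ<n j) m<k) eq)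
    ; edges = edge
    }
    where
    edge : ∀ i → Adj G (vertexAt (s + toℕ i)) (vertexAt (s + toℕ (next i)))
    edge i with m≤n⇒m<n∨m≡n (toℕ<n i)
    ... | inj₁ 1+i<1+m =
      subst (λ t → Adj G (vertexAt (s + toℕ i)) (vertexAt t))
            (trans (sym (+-suc s (toℕ i))) (cong (s +_) (sym (trans (toℕ-next i) (m<n⇒m%n≡m 1+i<1+m)))))
            (vertexAt-adjacent (s + toℕ i))
    ... | inj₂ 1+i≡1+m =
      subst₂ (λ x y → Adj G (vertexAt x) (vertexAt y))
             (cong (s +_) (sym (suc-injective 1+i≡1+m)))
             (sym (trans (cong (s +_) (trans (toℕ-next i) (trans (cong (_% suc m) 1+i≡1+m) (n%n≡0 (suc m)))))
                         (+-identityʳ s)))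
             closing

  record Chord : Set where
    field
      start span cospan : ℕ
      span≥2   : 2 ≤ span
      cospan≥2 : 2 ≤ cospan
      spans    : span + cospan ≡ k
      adjacent : Adj G (vertexAt start) (vertexAt (start + span))

  module _ (c : Chord) where
    open Chord c

    shortcut : Cycle G (suc span)
    shortcut = arc start span span≥2
      (subst (span <_) spans (m<m+n span (≤-trans (s≤s z≤n) cospan≥2)))
      (SimpleGraph.sym G adjacent)

    detour : Cycle G (suc cospan)
    detour = arc (start + span) cospan cospan≥2
      (subst (cospan <_) spans (m<n+m cospan (≤-trans (s≤s z≤n) span≥2)))
      (subst (λ v → Adj G v (vertexAt (start + span))) (sym round-trip) adjacent)
      where
      round-trip : vertexAt (start + span + cospan) ≡ vertexAt start
      round-trip = trans (cong vertexAt (trans (+-assoc start span cospan) (cong (start +_) spans)))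
                         (vertexAt-+k start)

  chordless? : ∀ i j → Dec (Adj G (vert C i) (vert C j) → (j ≡ next i) ⊎ (i ≡ next j))
  chordless? i j = dec G _ _ →-dec ((j ≟ᶠ next i) ⊎-dec (i ≟ᶠ next j))

  induced? : Dec (Induced C)
  induced? = all? λ i → all? (chordless? i)

  chord-between : ∀ i j → toℕ i < toℕ j → Adj G (vert C i) (vert C j) → j ≢ next i → i ≢ next j → Chord
  chord-between i j i<j adj j≢next-i i≢next-j
    with chord-spans i<j (toℕ<n j) (λ eq → j≢next-i (toℕ-injective (trans eq (sym (toℕ-next i)))))
                                   (λ eq → i≢next-j (toℕ-injective (trans eq (sym (toℕ-next j)))))
  ... | span , cospan , span≥2 , cospan≥2 , spans , i+span≡j = record
    { start    = toℕ i
    ; span     = span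
    ; cospan   = cospan
    ; span≥2   = span≥2
    ; cospan≥2 = cospan≥2
    ; spans    = spans
    ; adjacent = subst₂ (Adj G) (sym (vertexAt-toℕ i)) (sym (trans (cong vertexAt i+span≡j) (vertexAt-toℕ j))) adj
    }

  ¬Induced⇒Chord : ¬ Induced C → Chord
  ¬Induced⇒Chord ¬induced with ¬∀⟶∃¬ k _ (λ i → all? (chordless? i)) ¬induced
  ... | i , ¬chordless-i with ¬∀⟶∃¬ k _ (chordless? i) ¬chordless-i
  ... | j , ¬chordless-ij with dec G (vert C i) (vert C j)
  ... | no ¬adj = contradiction (λ adj → contradiction adj ¬adj) ¬chordless-ij
  ... | yes adj with <-cmp (toℕ i) (toℕ j)
  ... | tri< i<j _ _ = chord-between i j i<j adj (¬chordless-ij ∘ const ∘ inj₁) (¬chordless-ij ∘ const ∘ inj₂)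
  ... | tri≈ _ i≡j _ = contradiction (subst (Adj G (vert C i) ∘ vert C) (sym (toℕ-injective i≡j)) adj) (irrefl G)
  ... | tri> _ _ j<i = chord-between j i j<i (SimpleGraph.sym G adj)
                         (¬chordless-ij ∘ const ∘ inj₂) (¬chordless-ij ∘ const ∘ inj₁)

module _ {n : ℕ} {G : SimpleGraph n} where

  shorter-bad-cycle : ∀ {k} (C : Cycle G k) → Bad k → ¬ Induced C → ∃ λ k′ → k′ < k × Bad k′ × Cycle G k′
  shorter-bad-cycle {k} C bad ¬induced =
    [ (λ bad-shortcut → suc span , shortcut-shorter , bad-shortcut , shortcut C chord)
    , (λ bad-detour → suc cospan , detour-shorter , bad-detour , detour C chord)
    ]′ (Bad-split (suc span) (suc cospan) arcs-total bad)
    where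
    chord : Chord C
    chord = ¬Induced⇒Chord C ¬induced
    open Chord chord
    arcs-total : suc span + suc cospan ≡ 2 + k
    arcs-total = cong suc (trans (+-suc span cospan) (cong suc spans))
    shortcut-shorter : suc span < k
    shortcut-shorter = subst (suc span <_) (trans (+-comm cospan span) spans) (+-monoˡ-≤ span cospan≥2)
    detour-shorter : suc cospan < k
    detour-shorter = subst (suc cospan <_) spans (+-monoˡ-≤ cospan span≥2)

  HasBadInducedCycle : Set
  HasBadInducedCycle = ∃ λ k → Bad k × HasInducedCycleOfLength G k

  bad-cycle⇒bad-induced-cycle : ∀ k → Bad k → Cycle G k → HasBadInducedCycle
  bad-cycle⇒bad-induced-cycle = <-rec (λ k → Bad k → Cycle G k → HasBadInducedCycle) step
    where
    step : ∀ k → (∀ {k′} → k′ < k → Bad k′ → Cycle G k′ → HasBadInducedCycle) →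
           Bad k → Cycle G k → HasBadInducedCycle
    step k recurse bad C with induced? C
    ... | yes induced = k , bad , C , induced
    ... | no ¬induced = let (_ , k′<k , bad′ , C′) = shorter-bad-cycle C bad ¬induced in recurse k′<k bad′ C′

proposition1p2 : ∀ {n : ℕ} (G : SimpleGraph n) →
    ((∀ k → Bad k → ¬ HasInducedCycleOfLength G k) → (∀ k → Bad k → ¬ HasCycleOfLength G k))
    × ((∀ k → Bad k → ¬ HasCycleOfLength G k) → (∀ k → Bad k → ¬ HasInducedCycleOfLength G k))
proposition1p2 G =
    (λ no-induced k bad C → let (k′ , bad′ , induced) = bad-cycle⇒bad-induced-cycle k bad C in no-induced k′ bad′ induced)
  , (λ no-cycle k bad (C , _) → no-cycle k bad C)
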